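{- Let $m > 1$. For every sufficiently large $s$, there exists a sequence of $s$ job insertions/deletions on $m$ machines such that the following holds: every deterministic reallocating scheduler that maintains a feasible schedule of the active jobs after every request incurs total migration cost $\Omega(s)$ over the sequence.
   Context: There are $m$ identical machines with unit timeslots. Each job has length $1$, an integer arrival time $a$ and an integer deadline $d>a$. Its window is $[a,d]$. A feasible schedule assigns each job to a machine and a unit timeslot within its window, with no two jobs on the same machine in the same timeslot. Requests (job insertions and deletions) are processed online. After each request the scheduler must output a feasible schedule of the active jobs, and may move previously scheduled jobs. The migration cost of a request is the number of jobs whose assigned machine changes when the request is processed. The total migration cost is the sum of these costs over the sequence. -}

module Defs where

open import Data.Nat using (ℕ; zero; suc; _+_; _*_; _≤_; _<_)
open import Data.Nat.Properties using (_≟_)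
open import Data.Fin using (Fin; toℕ)
import Data.Fin as F
open import Data.Bool using (Bool; true; false; _∧_; _∨_; not)
open import Data.Maybe using (Maybe; just; nothing; is-just)
open import Data.List using (List; []; _∷_; length; take; lookup)
open import Data.Product using (Σ; _×_; _,_; proj₁; proj₂; ∃-syntax)
open import Relation.Nullary using (¬_)
open import Relation.Nullary.Decidable using (⌊_⌋)
open import Relation.Binary.PropositionalEquality using (_≡_; _≢_)

-- A job is identified by the (0-based)
-- position in the request sequence of the request that inserted it;
-- `del i` deletes the job inserted by request number i.
data Request : Set where
  ins : (a d : ℕ) → Request
  del : (i : ℕ) → Request

jobAt : List Request → ℕ → Maybe (ℕ × ℕ)
jobAt []             _       = nothing
jobAt (ins a d ∷ ρ)  zero    = just (a , d)
jobAt (del _ ∷ ρ)    zero    = nothing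
jobAt (_ ∷ ρ)        (suc j) = jobAt ρ j

deleted : List Request → ℕ → Bool
deleted []            j = false
deleted (ins _ _ ∷ ρ) j = deleted ρ j
deleted (del i ∷ ρ)   j = ⌊ i ≟ j ⌋ ∨ deleted ρ j

active : List Request → ℕ → Bool
active ρ j = is-just (jobAt ρ j) ∧ not (deleted ρ j)

-- a schedule assigns every job (id) a machine and a unit timeslot;
-- timeslot t is the unit interval [t, t+1]
Schedule : ℕ → Set
Schedule m = ℕ → Fin m × ℕ

Feasible : (m : ℕ) → List Request → Schedule m → Set
Feasible m ρ S =
  (∀ j a d → jobAt ρ j ≡ just (a , d) → deleted ρ j ≡ false →
     a ≤ proj₂ (S j) × suc (proj₂ (S j)) ≤ d)
  × (∀ j j′ → j ≢ j′ → active ρ j ≡ true → active ρ j′ ≡ true → S j ≢ S j′)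

ValidStep : List Request → Request → Set
ValidStep ρ (ins a d) = a < d
ValidStep ρ (del i)   = active ρ i ≡ true

ValidSeq : List Request → Set
ValidSeq σ = (k : Fin (length σ)) → ValidStep (take (toℕ k) σ) (lookup σ k)

FeasiblePrefixes : ℕ → List Request → Set
FeasiblePrefixes m σ = ∀ k → k ≤ length σ → ∃[ S ] Feasible m (take k σ) S

count : (ℕ → Bool) → ℕ → ℕ
count f zero    = 0
count f (suc n) = count f n + (if f n then 1 else 0)
  where open import Data.Bool using (if_then_else_)

migration : (m : ℕ) → List Request → List Request → Schedule m → Schedule m → ℕ
migration m ρ ρ′ S S′ =
  count (λ j → active ρ j ∧ active ρ′ j ∧ not ⌊ proj₁ (S j) F.≟ proj₁ (S′ j) ⌋)
        (length ρ′)

-- A deterministic online scheduler: maps the requests seen so far to the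
-- schedule it outputs after processing them.
Scheduler : ℕ → Set
Scheduler m = List Request → Schedule m

costUpTo : (m : ℕ) → List Request → Scheduler m → ℕ → ℕ
costUpTo m σ A zero    = 0
costUpTo m σ A (suc k) =
  costUpTo m σ A k
  + migration m (take k σ) (take (suc k) σ) (A (take k σ)) (A (take (suc k) σ))

totalCost : (m : ℕ) → List Request → Scheduler m → ℕ
totalCost m σ A = costUpTo m σ A (length σ)

-- Every round of L requests forces a migration.  In round r, with slots T = 2r and T + 1, the
-- adversary inserts a job X with window [T, T+2], m jobs F i with window [T, T+1] and m − 1 jobs
-- Y i with window [T+1, T+2].  Slot T is full, so X runs at T + 1, on a machine different from
-- those of all Y i.  Deleting F 0 and inserting Z with window [T+1, T+2] puts Z on a machine
-- different from those of all Y i.  Deleting Y 0 and inserting F′ with window [T, T+1] fills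
-- slot T again, so X runs at T + 1 on a machine different from that of Z.  If nothing migrates
-- during the round, X, Z and the Y i keep their machines, so m + 1 jobs sit on pairwise distinct
-- machines out of m.  Hence s ≥ L requests cost at least ⌊s / L⌋ ≥ s / 2L migrations.
module Submission where

open import Defs
open import Data.Bool using (true; false; _∧_; not)
open import Data.Bool.Properties using (∨-zeroʳ; ¬-not)
open import Data.Empty using (⊥; ⊥-elim)
open import Data.Fin using (Fin; toℕ) renaming (zero to fz; suc to fs)
import Data.Fin as Fin
open import Data.Fin.Properties using (toℕ<n; injective⇒≤)
open import Data.List using (List; []; _∷_; length; take; applyUpTo)
open import Data.List.Properties using (length-applyUpTo; lookup-applyUpTo)
open import Data.List.Membership.Propositional using (_∈_)
open import Data.List.Membership.Propositional.Properties using (∈-applyUpTo⁺; ∈-applyUpTo⁻)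
open import Data.List.Relation.Unary.Any using (here; there)
open import Data.Maybe using (Maybe; just; nothing; is-just)
open import Data.Nat using (ℕ; zero; suc; _+_; _*_; _≤_; _<_; z≤n; s≤s; _<?_; NonZero)
open import Data.Nat.DivMod
  using (_/_; _%_; m≡m%n+[m/n]*n; m%n<n; m/n*n≤m; m≥n⇒m/n>0; [m+kn]%n≡m%n; m<n⇒m%n≡m; m*n%n≡0;
         +-distrib-/; m<n⇒m/n≡0; m*n/n≡m)
open import Data.Nat.Properties
open import Data.Product using (_×_; _,_; proj₁; proj₂; ∃; ∃-syntax)
open import Data.Sum using (_⊎_; inj₁; inj₂; [_,_]′)
open import Function using (_∘_)
open import Function.Definitions using (Injective)
open import Relation.Nullary using (Dec; yes; no; ¬_; contradiction)
open import Relation.Nullary.Decidable using (⌊_⌋)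
open import Relation.Binary.PropositionalEquality

window : Request → Maybe (ℕ × ℕ)
window (ins a d) = just (a , d)
window (del _)   = nothing

jobAt-here : ∀ x ρ → jobAt (x ∷ ρ) 0 ≡ window x
jobAt-here (ins a d) ρ = refl
jobAt-here (del i)   ρ = refl

jobAt-there : ∀ x ρ j → jobAt (x ∷ ρ) (suc j) ≡ jobAt ρ j
jobAt-there (ins a d) ρ j = refl
jobAt-there (del i)   ρ j = refl

jobAt-applyUpTo : ∀ f {n j} → j < n → jobAt (applyUpTo f n) j ≡ window (f j)
jobAt-applyUpTo f {suc n} {zero}  _         = jobAt-here (f 0) _
jobAt-applyUpTo f {suc n} {suc j} (s≤s j<n) =
  trans (jobAt-there (f 0) _ j) (jobAt-applyUpTo (f ∘ suc) j<n)

jobAt-beyond : ∀ ρ {j} → length ρ ≤ j → jobAt ρ j ≡ nothing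
jobAt-beyond []      _         = refl
jobAt-beyond (x ∷ ρ) (s≤s ρ≤j) = trans (jobAt-there x ρ _) (jobAt-beyond ρ ρ≤j)

take-applyUpTo : ∀ {A : Set} (f : ℕ → A) {k n} → k ≤ n → take k (applyUpTo f n) ≡ applyUpTo f k
take-applyUpTo f {zero}          _         = refl
take-applyUpTo f {suc k} {suc n} (s≤s k≤n) = cong (f 0 ∷_) (take-applyUpTo (f ∘ suc) k≤n)

del∈⇒deleted : ∀ {ρ j} → del j ∈ ρ → deleted ρ j ≡ true
del∈⇒deleted {del i ∷ ρ} (here refl) with i ≟ i
... | yes _   = refl
... | no i≢i = contradiction refl i≢i
del∈⇒deleted {ins a d ∷ ρ} (there p) = del∈⇒deleted p
del∈⇒deleted {del i ∷ ρ} {j} (there p) rewrite del∈⇒deleted {ρ} p = ∨-zeroʳ ⌊ i ≟ j ⌋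

deleted⇒del∈ : ∀ ρ {j} → deleted ρ j ≡ true → del j ∈ ρ
deleted⇒del∈ (ins a d ∷ ρ) eq = there (deleted⇒del∈ ρ eq)
deleted⇒del∈ (del i ∷ ρ) {j} eq with i ≟ j
... | yes refl = here refl
... | no  _    = there (deleted⇒del∈ ρ eq)

active-intro : ∀ ρ {j} → is-just (jobAt ρ j) ≡ true → deleted ρ j ≡ false → active ρ j ≡ true
active-intro ρ listed notDeleted rewrite listed | notDeleted = refl

active⇒listed : ∀ ρ {j} → active ρ j ≡ true → is-just (jobAt ρ j) ≡ true
active⇒listed ρ {j} act with is-just (jobAt ρ j)
... | true = refl

active⇒not-deleted : ∀ ρ {j} → active ρ j ≡ true → deleted ρ j ≡ false
active⇒not-deleted ρ {j} act with is-just (jobAt ρ j) | deleted ρ j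
... | true | false = refl

active⇒<length : ∀ ρ {j} → active ρ j ≡ true → j < length ρ
active⇒<length ρ {j} act with j <? length ρ
... | yes j<ρ = j<ρ
... | no  j≮ρ with () ← trans (sym (cong is-just (jobAt-beyond ρ (≮⇒≥ j≮ρ)))) (active⇒listed ρ act)

count≡0⇒false : ∀ f {N j} → count f N ≡ 0 → j < N → f j ≡ false
count≡0⇒false f {suc N} {j} total≡0 j<N with f N in fN | m≤n⇒m<n∨m≡n (≤-pred j<N)
... | true  | _          = contradiction (trans (sym (+-comm (count f N) 1)) total≡0) λ ()
... | false | inj₁ j<N′ = count≡0⇒false f (trans (sym (+-identityʳ (count f N))) total≡0) j<N′
... | false | inj₂ refl  = fN

migration≡0⇒machine-kept : ∀ {m} ρ ρ′ (S S′ : Schedule m) {j} → migration m ρ ρ′ S S′ ≡ 0 →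
  j < length ρ′ → active ρ j ≡ true → active ρ′ j ≡ true → proj₁ (S j) ≡ proj₁ (S′ j)
migration≡0⇒machine-kept ρ ρ′ S S′ {j} free j<ρ′ act act′ =
  witness (proj₁ (S j) Fin.≟ proj₁ (S′ j)) (unmoved (count≡0⇒false _ free j<ρ′))
  where
    unmoved : active ρ j ∧ active ρ′ j ∧ not ⌊ proj₁ (S j) Fin.≟ proj₁ (S′ j) ⌋ ≡ false →
              not ⌊ proj₁ (S j) Fin.≟ proj₁ (S′ j) ⌋ ≡ false
    unmoved moved rewrite act | act′ = moved
    witness : ∀ {A : Set} (a? : Dec A) → not ⌊ a? ⌋ ≡ false → A
    witness (yes a) _ = a

machine-kept : ∀ {m} (ρ : ℕ → List Request) (S : ℕ → Schedule m) {j a b} → a ≤ b →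
  (∀ q → a ≤ q → q < b → migration m (ρ q) (ρ (suc q)) (S q) (S (suc q)) ≡ 0) →
  (∀ q → a ≤ q → q ≤ b → active (ρ q) j ≡ true) →
  proj₁ (S a j) ≡ proj₁ (S b j)
machine-kept ρ S {j} {a} {zero} z≤n free act = refl
machine-kept ρ S {j} {a} {suc b} a≤b+1 free act with m≤n⇒m<n∨m≡n a≤b+1
... | inj₂ refl = refl
... | inj₁ (s≤s a≤b) =
  trans (machine-kept ρ S a≤b (λ q a≤q q<b → free q a≤q (m≤n⇒m≤1+n q<b))
                               (λ q a≤q q≤b → act q a≤q (m≤n⇒m≤1+n q≤b)))
        (migration≡0⇒machine-kept (ρ b) (ρ (suc b)) (S b) (S (suc b)) (free b a≤b ≤-refl)
          (active⇒<length (ρ (suc b)) act′) (act b a≤b (n≤1+n b)) act′)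
  where act′ = act (suc b) (m≤n⇒m≤1+n a≤b) ≤-refl

Feasible⇒within-window : ∀ {m ρ S j a d} → Feasible m ρ S → active ρ j ≡ true →
  jobAt ρ j ≡ just (a , d) →  a ≤ proj₂ (S j) × suc (proj₂ (S j)) ≤ d
Feasible⇒within-window {ρ = ρ} {j = j} (windows , _) act listed =
  windows j _ _ listed (active⇒not-deleted ρ act)

Feasible⇒injective : ∀ {m ρ S j j′} → Feasible m ρ S → active ρ j ≡ true → active ρ j′ ≡ true →
  S j ≡ S j′ → j ≡ j′
Feasible⇒injective {j = j} {j′} (_ , disjoint) act act′ sameCell with j ≟ j′
... | yes j≡j′ = j≡j′
... | no  j≢j′ = contradiction sameCell (disjoint j j′ j≢j′ act act′)

Feasible⇒slot-capacity : ∀ {m ρ S t} → Feasible m ρ S → (g : Fin (suc m) → ℕ) → Injective _≡_ _≡_ g →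
  (∀ i → active ρ (g i) ≡ true) → (∀ i → proj₂ (S (g i)) ≡ t) → ⊥
Feasible⇒slot-capacity {m} {ρ} {S} feasible g g-injective act inSlot =
  1+n≰n (injective⇒≤ machine-injective)
  where
    machine-injective : Injective _≡_ _≡_ (λ i → proj₁ (S (g i)))
    machine-injective {i} {i′} sameMachine =
      g-injective (Feasible⇒injective {ρ = ρ} feasible (act i) (act i′)
                     (cong₂ _,_ sameMachine (trans (inSlot i) (sym (inSlot i′)))))

stepCost : (m : ℕ) → List Request → Scheduler m → ℕ → ℕ
stepCost m σ A k = migration m (take k σ) (take (suc k) σ) (A (take k σ)) (A (take (suc k) σ))

costUpTo-mono : ∀ {m} σ (A : Scheduler m) {a b} → a ≤ b → costUpTo m σ A a ≤ costUpTo m σ A b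
costUpTo-mono σ A {a} {zero} z≤n = ≤-refl
costUpTo-mono σ A {a} {suc b} a≤b+1 with m≤n⇒m<n∨m≡n a≤b+1
... | inj₂ refl      = ≤-refl
... | inj₁ (s≤s a≤b) = ≤-trans (costUpTo-mono σ A a≤b) (m≤m+n _ _)

costUpTo-grows-or-free : ∀ {m} σ (A : Scheduler m) {a b} → a ≤ b →
  costUpTo m σ A a < costUpTo m σ A b ⊎ (∀ q → a ≤ q → q < b → stepCost m σ A q ≡ 0)
costUpTo-grows-or-free σ A {a} {zero} z≤n = inj₂ λ _ _ ()
costUpTo-grows-or-free {m} σ A {a} {suc b} a≤b+1 with m≤n⇒m<n∨m≡n a≤b+1
... | inj₂ refl = inj₂ λ q b+1≤q q<b+1 → contradiction b+1≤q (<⇒≱ q<b+1)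
... | inj₁ (s≤s a≤b) with costUpTo-grows-or-free σ A a≤b | stepCost m σ A b in step
...   | inj₁ grows | _     = inj₁ (<-≤-trans grows (m≤m+n _ _))
...   | inj₂ free  | suc c = inj₁ (≤-<-trans (costUpTo-mono σ A a≤b) (m<m+n _ (s≤s z≤n)))
...   | inj₂ free  | zero  =
  inj₂ λ q a≤q q<b+1 → [ free q a≤q , (λ { refl → step }) ]′ (m≤n⇒m<n∨m≡n (≤-pred q<b+1))

[m+kn]%n≡m : ∀ {m n} k .{{_ : NonZero n}} → m < n → (m + k * n) % n ≡ m
[m+kn]%n≡m {m} {n} k m<n = trans ([m+kn]%n≡m%n m k n) (m<n⇒m%n≡m m<n)

[m+kn]/n≡k : ∀ {m n} k .{{_ : NonZero n}} → m < n → (m + k * n) / n ≡ k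
[m+kn]/n≡k {m} {n} k m<n = begin
  (m + k * n) / n       ≡⟨ +-distrib-/ m (k * n) remainders<n ⟩
  m / n + k * n / n     ≡⟨ cong₂ _+_ (m<n⇒m/n≡0 m<n) (m*n/n≡m k n) ⟩
  k                     ∎
  where
    open ≡-Reasoning
    remainders<n : m % n + k * n % n < n
    remainders<n = subst (_< n) (sym (trans (cong₂ _+_ (m<n⇒m%n≡m m<n) (m*n%n≡0 k n)) (+-identityʳ m))) m<n

≤-suc⇒≡⊎≡suc : ∀ {a x} → a ≤ x → x ≤ suc a → x ≡ a ⊎ x ≡ suc a
≤-suc⇒≡⊎≡suc a≤x x≤a+1 with m≤n⇒m<n∨m≡n x≤a+1
... | inj₁ x<a+1 = inj₁ (≤-antisym (≤-pred x<a+1) a≤x)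
... | inj₂ x≡a+1 = inj₂ x≡a+1

≤-double-quotient : ∀ s n .{{_ : NonZero n}} → n ≤ s → s ≤ (n + n) * (s / n)
≤-double-quotient s n n≤s = begin
  s                           ≡⟨ m≡m%n+[m/n]*n s n ⟩
  s % n + s / n * n           ≤⟨ +-monoˡ-≤ (s / n * n) (≤-trans (<⇒≤ (m%n<n s n)) n≤[s/n]*n) ⟩
  s / n * n + s / n * n       ≡⟨ cong₂ _+_ (*-comm (s / n) n) (*-comm (s / n) n) ⟩
  n * (s / n) + n * (s / n)   ≡⟨ *-distribʳ-+ (s / n) n n ⟨
  (n + n) * (s / n)           ∎
  where
    open ≤-Reasoning
    n≤[s/n]*n : n ≤ s / n * n
    n≤[s/n]*n = subst (_≤ s / n * n) (*-identityˡ n) (*-monoˡ-≤ n (m≥n⇒m/n>0 n≤s))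

data Split (k : ℕ) : ℕ → Set where
  inside : (i : Fin k) → Split k (toℕ i)
  beyond : (q : ℕ) → Split k (k + q)

split : ∀ k p → Split k p
split zero    p       = beyond p
split (suc k) zero    = inside fz
split (suc k) (suc p) with split k p
... | inside i = inside (fs i)
... | beyond q = beyond q

split-inside : ∀ {k} (i : Fin k) → split k (toℕ i) ≡ inside i
split-inside fz     = refl
split-inside (fs i) rewrite split-inside i = refl

split-beyond : ∀ k q → split k (k + q) ≡ beyond q
split-beyond zero    q = refl
split-beyond (suc k) q rewrite split-beyond k q = refl

-- The adversary

module Adversary (n : ℕ) where

  m : ℕ
  m = suc (suc n)

  data Kind : Set where
    X     : Kind
    F     : Fin m → Kind
    Y     : Fin (suc n) → Kind
    DF Z DY F′ : Kind

  lastPos : ℕ → ℕ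
  lastPos w = suc (m + (suc n + w))

  L : ℕ
  L = lastPos 4

  pos : Kind → ℕ
  pos X     = 0
  pos (F i) = suc (toℕ i)
  pos (Y i) = suc (m + toℕ i)
  pos DF    = lastPos 0
  pos Z     = lastPos 1
  pos DY    = lastPos 2
  pos F′    = lastPos 3

  decode : ℕ → Kind
  decode zero    = X
  decode (suc p) with split m p
  ... | inside i = F i
  ... | beyond q with split (suc n) q
  ...   | inside i = Y i
  ...   | beyond 0 = DF
  ...   | beyond 1 = Z
  ...   | beyond 2 = DY
  ...   | beyond _ = F′

  decode-pos : ∀ K → decode (pos K) ≡ K
  decode-pos X     = refl
  decode-pos (F i) rewrite split-inside i = refl
  decode-pos (Y i) rewrite split-beyond m (toℕ i) | split-inside i = refl
  decode-pos DF    rewrite split-beyond m (suc n + 0) | split-beyond (suc n) 0 = refl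
  decode-pos Z     rewrite split-beyond m (suc n + 1) | split-beyond (suc n) 1 = refl
  decode-pos DY    rewrite split-beyond m (suc n + 2) | split-beyond (suc n) 2 = refl
  decode-pos F′    rewrite split-beyond m (suc n + 3) | split-beyond (suc n) 3 = refl

  pos-decode : ∀ p → p < L → pos (decode p) ≡ p
  pos-decode zero    _   = refl
  pos-decode (suc p) p<L with split m p
  ... | inside i = refl
  ... | beyond q with split (suc n) q
  ...   | inside i = refl
  ...   | beyond w with +-cancelˡ-< (suc n) w 4 (+-cancelˡ-< m _ _ (≤-pred p<L))
  ...     | s≤s z≤n                   = refl
  ...     | s≤s (s≤s z≤n)             = refl
  ...     | s≤s (s≤s (s≤s z≤n))       = refl
  ...     | s≤s (s≤s (s≤s (s≤s z≤n))) = refl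

  lastPos-mono : ∀ {w w′} → w < w′ → lastPos w < lastPos w′
  lastPos-mono w<w′ = s≤s (+-monoʳ-< m (+-monoʳ-< (suc n) w<w′))

  pos<L : ∀ K → pos K < L
  pos<L X     = s≤s z≤n
  pos<L (F i) = s≤s (<-≤-trans (toℕ<n i) (m≤m+n m _))
  pos<L (Y i) = s≤s (+-monoʳ-< m (<-≤-trans (toℕ<n i) (m≤m+n (suc n) 4)))
  pos<L DF    = lastPos-mono (s≤s z≤n)
  pos<L Z     = lastPos-mono (s≤s (s≤s z≤n))
  pos<L DY    = lastPos-mono (s≤s (s≤s (s≤s z≤n)))
  pos<L F′    = lastPos-mono (s≤s (s≤s (s≤s (s≤s z≤n))))

  index : ℕ → Kind → ℕ
  index r K = pos K + r * L

  round : ℕ → ℕ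
  round t = t / L

  kind : ℕ → Kind
  kind t = decode (t % L)

  index-round-kind : ∀ t → index (round t) (kind t) ≡ t
  index-round-kind t =
    trans (cong (_+ t / L * L) (pos-decode (t % L) (m%n<n t L))) (sym (m≡m%n+[m/n]*n t L))

  round-index : ∀ r K → round (index r K) ≡ r
  round-index r K = [m+kn]/n≡k r (pos<L K)

  kind-index : ∀ r K → kind (index r K) ≡ K
  kind-index r K = trans (cong decode ([m+kn]%n≡m r (pos<L K))) (decode-pos K)

  index-injective : ∀ {r r′ K K′} → index r K ≡ index r′ K′ → r ≡ r′ × K ≡ K′
  index-injective {r} {r′} {K} {K′} eq =
    trans (sym (round-index r K)) (trans (cong round eq) (round-index r′ K′)) ,
    trans (sym (kind-index r K)) (trans (cong kind eq) (kind-index r′ K′))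

  index-injectiveʳ : ∀ r {K K′} → index r K ≡ index r K′ → K ≡ K′
  index-injectiveʳ r {K} {K′} = proj₂ ∘ index-injective {r} {r} {K} {K′}

  index-< : ∀ r K K′ → pos K < pos K′ → index r K < index r K′
  index-< r K K′ = +-monoˡ-< (r * L)

  request : ℕ → Kind → Request
  request r X     = ins (r * 2) (2 + r * 2)
  request r (F _) = ins (r * 2) (1 + r * 2)
  request r (Y _) = ins (1 + r * 2) (2 + r * 2)
  request r DF    = del (index r (F fz))
  request r Z     = ins (1 + r * 2) (2 + r * 2)
  request r DY    = del (index r (Y fz))
  request r F′    = ins (r * 2) (1 + r * 2)

  requestAt : ℕ → Request
  requestAt t = request (round t) (kind t)

  requestAt-index : ∀ r K → requestAt (index r K) ≡ request r K
  requestAt-index r K = cong₂ request (round-index r K) (kind-index r K)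

  prefix : ℕ → List Request
  prefix = applyUpTo requestAt

  data IsJob : Kind → Set where
    X  : IsJob X
    F  : ∀ i → IsJob (F i)
    Y  : ∀ i → IsJob (Y i)
    Z  : IsJob Z
    F′ : IsJob F′

  data Deletes : Kind → Kind → Set where
    DF : Deletes DF (F fz)
    DY : Deletes DY (Y fz)

  Active : ℕ → ℕ → Kind → Set
  Active q r K = active (prefix q) (index r K) ≡ true

  jobAt-prefix : ∀ {q r K} → index r K < q → jobAt (prefix q) (index r K) ≡ window (request r K)
  jobAt-prefix {r = r} {K} index<q = trans (jobAt-applyUpTo requestAt index<q) (cong window (requestAt-index r K))

  request-del : ∀ {r D j} → request r D ≡ del j → ∃ λ K → Deletes D K × j ≡ index r K
  request-del {D = DF} refl = F fz , DF , refl
  request-del {D = DY} refl = Y fz , DY , refl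

  deleted-prefix⇒ : ∀ {q} r K → deleted (prefix q) (index r K) ≡ true → ∃ λ D → Deletes D K × index r D < q
  deleted-prefix⇒ {q} r K isDeleted with ∈-applyUpTo⁻ requestAt (deleted⇒del∈ (prefix q) isDeleted)
  ... | t , t<q , deletion with request-del (sym deletion)
  ...   | K′ , deletes , same-index with index-injective {r} {round t} {K} {K′} same-index
  ...     | refl , refl = kind t , deletes , subst (_< q) (sym (index-round-kind t)) t<q

  deleted-prefix⇐ : ∀ {q} r {D K} → Deletes D K → index r D < q → deleted (prefix q) (index r K) ≡ true
  deleted-prefix⇐ {q} r {D} deletes index<q =
    del∈⇒deleted (subst (_∈ prefix q) (trans (requestAt-index r D) (deletion deletes))
                        (∈-applyUpTo⁺ requestAt index<q))
    where
      deletion : ∀ {D K} → Deletes D K → request r D ≡ del (index r K)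
      deletion DF = refl
      deletion DY = refl

  active-prefix : ∀ {q} r {K} → IsJob K → index r K < q → (∀ {D} → Deletes D K → q ≤ index r D) →
             Active q r K
  active-prefix {q} r {K} job index<q undeleted =
    active-intro (prefix q) (trans (cong is-just (jobAt-prefix index<q)) (listed job)) (¬-not notDeleted)
    where
      listed : ∀ {K} → IsJob K → is-just (window (request r K)) ≡ true
      listed X     = refl
      listed (F i) = refl
      listed (Y i) = refl
      listed Z     = refl
      listed F′    = refl
      notDeleted : deleted (prefix q) (index r K) ≢ true
      notDeleted isDeleted with deleted-prefix⇒ r K isDeleted
      ... | D , deletes , index<q = <⇒≱ index<q (undeleted deletes)

  active-prefix⇒inserted : ∀ q r K → Active q r K → index r K < q
  active-prefix⇒inserted q r K act = subst (_ <_) (length-applyUpTo requestAt q) (active⇒<length (prefix q) act)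

  active-prefix⇒IsJob : ∀ q r K → Active q r K → IsJob K
  active-prefix⇒IsJob q r K act =
    unlisted K (trans (sym (cong is-just (jobAt-prefix {q} (active-prefix⇒inserted q r K act))))
                      (active⇒listed (prefix q) act))
    where
      unlisted : ∀ K → is-just (window (request r K)) ≡ true → IsJob K
      unlisted X     _ = X
      unlisted (F i) _ = F i
      unlisted (Y i) _ = Y i
      unlisted Z     _ = Z
      unlisted F′    _ = F′

  active-prefix⇒undeleted : ∀ q r {D K} → Active q r K → Deletes D K → q ≤ index r D
  active-prefix⇒undeleted q r act deletes = ≮⇒≥ λ index<q →
    contradiction (trans (sym (deleted-prefix⇐ r deletes index<q)) (active⇒not-deleted (prefix q) act)) λ ()

  DF<Z : ∀ r → index r DF < index r Z
  DF<Z r = index-< r DF Z (lastPos-mono (s≤s z≤n))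

  Z<DY : ∀ r → index r Z < index r DY
  Z<DY r = index-< r Z DY (lastPos-mono (s≤s (s≤s z≤n)))

  DY<F′ : ∀ r → index r DY < index r F′
  DY<F′ r = index-< r DY F′ (lastPos-mono (s≤s (s≤s (s≤s z≤n))))

  F<DF : ∀ r i → index r (F i) < index r DF
  F<DF r i = index-< r (F i) DF (s≤s (<-≤-trans (toℕ<n i) (m≤m+n m _)))

  Y<DF : ∀ r i → index r (Y i) < index r DF
  Y<DF r i = index-< r (Y i) DF (s≤s (+-monoʳ-< m (<-≤-trans (toℕ<n i) (m≤m+n (suc n) 0))))

  valid-request : ∀ r K → ValidStep (prefix (index r K)) (request r K)
  valid-request r X     = n≤1+n _
  valid-request r (F i) = ≤-refl
  valid-request r (Y i) = ≤-refl
  valid-request r DF    = active-prefix r (F fz) (F<DF r fz) λ { DF → ≤-refl }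
  valid-request r Z     = ≤-refl
  valid-request r DY    =
    active-prefix r (Y fz) (<-trans (Y<DF r fz) (<-trans (DF<Z r) (Z<DY r))) λ { DY → ≤-refl }
  valid-request r F′    = ≤-refl

  prefix-valid : ∀ s → ValidSeq (prefix s)
  prefix-valid s k =
    subst₂ ValidStep
      (sym (trans (take-applyUpTo requestAt (<⇒≤ k<s)) (cong prefix (sym (index-round-kind (toℕ k))))))
      (sym (lookup-applyUpTo requestAt s k))
      (valid-request (round (toℕ k)) (kind (toℕ k)))
    where k<s = subst (toℕ k <_) (length-applyUpTo requestAt s) (toℕ<n k)

  -- A feasible schedule for every prefix

  data Phase (k r : ℕ) : Set where
    before-Z : k ≤ index r Z → Phase k r
    between  : index r Z < k → k ≤ index r F′ → Phase k r
    after-F′ : index r F′ < k → Phase k r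

  phase : ∀ k r → Phase k r
  phase k r with index r F′ <? k | index r Z <? k
  ... | yes F′<k | _      = after-F′ F′<k
  ... | no  F′≮k | yes Z<k = between Z<k (≮⇒≥ F′≮k)
  ... | no  _    | no  Z≮k = before-Z (≮⇒≥ Z≮k)

  -- A machine and an offset (0 or 1) from the first slot 2r of round r.
  Cell : Set
  Cell = Fin m × ℕ

  place : ∀ {k r} → Kind → Phase k r → Cell
  place X     (before-Z _)  = fz , 1
  place X     (between _ _) = fz , 0
  place X     (after-F′ _)  = fs fz , 1
  place (F i) _             = i , 0
  place (Y i) _             = fs i , 1
  place Z     _             = fz , 1
  place F′    _             = fz , 0
  -- Deletion requests are never active jobs, so their cell is irrelevant.
  place DF    _             = fz , 0
  place DY    _             = fz , 0

  occupant : ∀ {k r} → Cell → Phase k r → Kind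
  occupant (fz , 0)            (before-Z _)  = F fz
  occupant (fz , 0)            (between _ _) = X
  occupant (fz , 0)            (after-F′ _)  = F′
  occupant (fs i , 0)          _             = F (fs i)
  occupant (fz , suc _)        (before-Z _)  = X
  occupant (fz , suc _)        _             = Z
  occupant (fs fz , suc _)     (after-F′ _)  = X
  occupant (fs fz , suc _)     _             = Y fz
  occupant (fs (fs i) , suc _) _             = Y (fs i)

  occupant-place : ∀ {k r K} (ph : Phase k r) → Active k r K → occupant (place K ph) ph ≡ K
  occupant-place {K = X} (before-Z _)  _ = refl
  occupant-place {K = X} (between _ _) _ = refl
  occupant-place {K = X} (after-F′ _)  _ = refl
  occupant-place {K = F fz} (before-Z _) _ = refl
  occupant-place {k} {r} {F fz} (between Z<k _) act =
    contradiction (<-trans (DF<Z r) Z<k) (≤⇒≯ (active-prefix⇒undeleted k r act DF))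
  occupant-place {k} {r} {F fz} (after-F′ F′<k) act =
    contradiction (<-trans (<-trans (DF<Z r) (<-trans (Z<DY r) (DY<F′ r))) F′<k)
                  (≤⇒≯ (active-prefix⇒undeleted k r act DF))
  occupant-place {K = F (fs i)} _ _ = refl
  occupant-place {K = Y fz} (before-Z _)  _ = refl
  occupant-place {K = Y fz} (between _ _) _ = refl
  occupant-place {k} {r} {Y fz} (after-F′ F′<k) act =
    contradiction (<-trans (DY<F′ r) F′<k) (≤⇒≯ (active-prefix⇒undeleted k r act DY))
  occupant-place {K = Y (fs i)} _ _ = refl
  occupant-place {k} {r} {Z} (before-Z k≤Z) act = contradiction (active-prefix⇒inserted k r Z act) (≤⇒≯ k≤Z)
  occupant-place {K = Z} (between _ _) _ = refl
  occupant-place {K = Z} (after-F′ _)  _ = refl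
  occupant-place {k} {r} {F′} (before-Z k≤Z) act =
    contradiction (active-prefix⇒inserted k r F′ act)
                  (≤⇒≯ (≤-trans k≤Z (<⇒≤ (<-trans (Z<DY r) (DY<F′ r)))))
  occupant-place {k} {r} {F′} (between _ k≤F′) act =
    contradiction (active-prefix⇒inserted k r F′ act) (≤⇒≯ k≤F′)
  occupant-place {K = F′} (after-F′ _) _ = refl
  occupant-place {k} {r} {DF} _ act with () ← active-prefix⇒IsJob k r DF act
  occupant-place {k} {r} {DY} _ act with () ← active-prefix⇒IsJob k r DY act

  atRound : ℕ → Cell → Fin m × ℕ
  atRound r (i , b) = i , b + r * 2

  schedule : ℕ → Schedule m
  schedule k j = atRound (round j) (place (kind j) (phase k (round j)))

  jobIn : ℕ → Fin m × ℕ → ℕ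
  jobIn k (i , t) = index (t / 2) (occupant (i , t % 2) (phase k (t / 2)))

  place-offset<2 : ∀ {k r} K (ph : Phase k r) → proj₂ (place K ph) < 2
  place-offset<2 X     (before-Z _)  = ≤-refl
  place-offset<2 X     (between _ _) = s≤s z≤n
  place-offset<2 X     (after-F′ _)  = ≤-refl
  place-offset<2 (F i) _             = s≤s z≤n
  place-offset<2 (Y i) _             = ≤-refl
  place-offset<2 Z     _             = ≤-refl
  place-offset<2 F′    _             = s≤s z≤n
  place-offset<2 DF    _             = s≤s z≤n
  place-offset<2 DY    _             = s≤s z≤n

  jobIn-atRound : ∀ k r (c : Cell) → proj₂ c < 2 → jobIn k (atRound r c) ≡ index r (occupant c (phase k r))
  jobIn-atRound k r (i , b) b<2 rewrite [m+kn]/n≡k r b<2 | [m+kn]%n≡m r b<2 = refl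

  jobIn-schedule : ∀ k {j} → active (prefix k) j ≡ true → jobIn k (schedule k j) ≡ j
  jobIn-schedule k {j} act = begin
    jobIn k (schedule k j)              ≡⟨ jobIn-atRound k r (place K ph) (place-offset<2 K ph) ⟩
    index r (occupant (place K ph) ph)  ≡⟨ cong (index r) (occupant-place ph act′) ⟩
    index r K                           ≡⟨ index-round-kind j ⟩
    j                                   ∎
    where
      open ≡-Reasoning
      r  = round j
      K  = kind j
      ph = phase k r
      act′ = subst (λ j → active (prefix k) j ≡ true) (sym (index-round-kind j)) act

  place-within-window : ∀ {k r K a d} (ph : Phase k r) → window (request r K) ≡ just (a , d) →
    a ≤ proj₂ (atRound r (place K ph)) × suc (proj₂ (atRound r (place K ph))) ≤ d
  place-within-window {K = X} (before-Z _)  refl = n≤1+n _ , ≤-refl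
  place-within-window {K = X} (between _ _) refl = ≤-refl , n≤1+n _
  place-within-window {K = X} (after-F′ _)  refl = n≤1+n _ , ≤-refl
  place-within-window {K = F i} _ refl = ≤-refl , ≤-refl
  place-within-window {K = Y i} _ refl = ≤-refl , ≤-refl
  place-within-window {K = Z}   _ refl = ≤-refl , ≤-refl
  place-within-window {K = F′}  _ refl = ≤-refl , ≤-refl

  schedule-feasible : ∀ k → Feasible m (prefix k) (schedule k)
  schedule-feasible k = within-windows , disjoint
    where
      within-windows : ∀ j a d → jobAt (prefix k) j ≡ just (a , d) → deleted (prefix k) j ≡ false →
                       a ≤ proj₂ (schedule k j) × suc (proj₂ (schedule k j)) ≤ d
      within-windows j a d listed _ with j <? k
      ... | yes j<k = place-within-window (phase k (round j))
                        (trans (sym (jobAt-applyUpTo requestAt j<k)) listed)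
      ... | no  j≮k = contradiction (trans (sym (jobAt-beyond (prefix k) |prefix|≤j)) listed) λ ()
        where |prefix|≤j = subst (_≤ j) (sym (length-applyUpTo requestAt k)) (≮⇒≥ j≮k)
      disjoint : ∀ j j′ → j ≢ j′ → active (prefix k) j ≡ true → active (prefix k) j′ ≡ true →
                 schedule k j ≢ schedule k j′
      disjoint j j′ j≢j′ act act′ sameCell =
        j≢j′ (trans (sym (jobIn-schedule k act)) (trans (cong (jobIn k) sameCell) (jobIn-schedule k act′)))

  feasible-prefixes : ∀ s → FeasiblePrefixes m (prefix s)
  feasible-prefixes s k k≤s =
    schedule k , subst (λ ρ → Feasible m ρ (schedule k)) (sym (take-applyUpTo requestAt k≤|σ|))
                       (schedule-feasible k)
    where k≤|σ| = subst (k ≤_) (length-applyUpTo requestAt s) k≤s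

  -- Every round forces a migration

  migrationAt : Scheduler m → ℕ → ℕ
  migrationAt A q = migration m (prefix q) (prefix (suc q)) (A (prefix q)) (A (prefix (suc q)))

  module RoundWithoutMigration (A : Scheduler m) (r : ℕ)
    (feasible : ∀ q → q ≤ suc (index r F′) → Feasible m (prefix q) (A (prefix q)))
    (free : ∀ q → index r DF ≤ q → q < suc (index r F′) → migrationAt A q ≡ 0) where

    -- q₁: X, all F i and all Y i are active; q₂: F 0 is replaced by Z; q₃: Y 0 is replaced by F′.
    T q₁ q₂ q₃ : ℕ
    T  = r * 2
    q₁ = index r DF
    q₂ = index r DY
    q₃ = suc (index r F′)

    q₁≤q₂ : q₁ ≤ q₂
    q₁≤q₂ = <⇒≤ (<-trans (DF<Z r) (Z<DY r))

    q₂≤q₃ : q₂ ≤ q₃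
    q₂≤q₃ = ≤-trans (<⇒≤ (DY<F′ r)) (n≤1+n _)

    q₁≤q₃ : q₁ ≤ q₃
    q₁≤q₃ = ≤-trans q₁≤q₂ q₂≤q₃

    machine : ℕ → Kind → Fin m
    machine q K = proj₁ (A (prefix q) (index r K))

    slot : ℕ → Kind → ℕ
    slot q K = proj₂ (A (prefix q) (index r K))

    X-active : ∀ q → q₁ ≤ q → Active q r X
    X-active q q₁≤q = active-prefix r X (<-≤-trans (index-< r X DF (s≤s z≤n)) q₁≤q) λ ()

    F-active : ∀ i → Active q₁ r (F i)
    F-active i = active-prefix r (F i) (F<DF r i) λ { DF → ≤-refl }

    Y-active : ∀ i q → q₁ ≤ q → q ≤ q₂ → Active q r (Y i)
    Y-active i q q₁≤q q≤q₂ = active-prefix r (Y i) (<-≤-trans (Y<DF r i) q₁≤q) λ { DY → q≤q₂ }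

    Z-active : ∀ q → q₂ ≤ q → Active q r Z
    Z-active q q₂≤q = active-prefix r Z (<-≤-trans (Z<DY r) q₂≤q) λ ()

    earlyJobs₃ : Fin m → Kind
    earlyJobs₃ fz     = F′
    earlyJobs₃ (fs i) = F (fs i)

    earlyJobs₃-active : ∀ i → Active q₃ r (earlyJobs₃ i)
    earlyJobs₃-active fz     = active-prefix r F′ ≤-refl λ ()
    earlyJobs₃-active (fs i) = active-prefix r (F (fs i)) (<-≤-trans (F<DF r (fs i)) q₁≤q₃) λ ()

    window-bounds : ∀ q → q ≤ q₃ → ∀ K {a d} → Active q r K → request r K ≡ ins a d →
                    a ≤ slot q K × suc (slot q K) ≤ d
    window-bounds q q≤q₃ K act eq =
      Feasible⇒within-window {ρ = prefix q} (feasible q q≤q₃) act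
        (trans (jobAt-prefix {q} (active-prefix⇒inserted q r K act)) (cong window eq))

    slot-early : ∀ q → q ≤ q₃ → ∀ K → Active q r K → request r K ≡ ins T (1 + T) →
                 slot q K ≡ T
    slot-early q q≤q₃ K act eq with window-bounds q q≤q₃ K act eq
    ... | T≤slot , slot<1+T = ≤-antisym (≤-pred slot<1+T) T≤slot

    slot-late : ∀ q → q ≤ q₃ → ∀ K → Active q r K → request r K ≡ ins (1 + T) (2 + T) →
                slot q K ≡ suc T
    slot-late q q≤q₃ K act eq with window-bounds q q≤q₃ K act eq
    ... | 1+T≤slot , slot<2+T = ≤-antisym (≤-pred slot<2+T) 1+T≤slot

    X-late : ∀ q → q ≤ q₃ → q₁ ≤ q → (G : Fin m → Kind) → Injective _≡_ _≡_ G →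
             (∀ i → request r (G i) ≡ ins T (1 + T)) → (∀ i → Active q r (G i)) →
             slot q X ≡ suc T
    X-late q q≤q₃ q₁≤q G G-injective G-early G-active
      with window-bounds q q≤q₃ X (X-active q q₁≤q) refl
    ... | T≤slot , slot<2+T with ≤-suc⇒≡⊎≡suc T≤slot (≤-pred slot<2+T)
    ...   | inj₂ late  = late
    ...   | inj₁ early =
      ⊥-elim (Feasible⇒slot-capacity {ρ = prefix q} (feasible q q≤q₃) row row-injective row-active row-slot)
      where
        row : Fin (suc m) → ℕ
        row fz     = index r X
        row (fs i) = index r (G i)
        X≢G : ∀ i → X ≢ G i
        X≢G i X≡G = ins-absurd (trans (cong (request r) X≡G) (G-early i))
          where
            ins-absurd : ∀ {a x} → ins a (suc (suc x)) ≢ ins a (suc x)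
            ins-absurd ()
        row-injective : Injective _≡_ _≡_ row
        row-injective {fz}   {fz}   _  = refl
        row-injective {fz}   {fs j} eq = ⊥-elim (X≢G j (index-injectiveʳ r eq))
        row-injective {fs i} {fz}   eq = ⊥-elim (X≢G i (sym (index-injectiveʳ r eq)))
        row-injective {fs i} {fs j} eq = cong fs (G-injective (index-injectiveʳ r eq))
        row-active : ∀ i → active (prefix q) (row i) ≡ true
        row-active fz     = X-active q q₁≤q
        row-active (fs i) = G-active i
        row-slot : ∀ i → proj₂ (A (prefix q) (row i)) ≡ T
        row-slot fz     = early
        row-slot (fs i) = slot-early q q≤q₃ (G i) (G-active i) (G-early i)

    same-kind : ∀ q → q ≤ q₃ → ∀ K K′ → Active q r K → Active q r K′ →
                slot q K ≡ slot q K′ → machine q K ≡ machine q K′ → K ≡ K′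
    same-kind q q≤q₃ K K′ act act′ sameSlot sameMachine =
      index-injectiveʳ r (Feasible⇒injective {ρ = prefix q} (feasible q q≤q₃) act act′
                            (cong₂ _,_ sameMachine sameSlot))

    machine-constant : ∀ {a b} K → q₁ ≤ a → a ≤ b → b ≤ q₃ → (∀ q → a ≤ q → q ≤ b → Active q r K) →
           machine a K ≡ machine b K
    machine-constant K q₁≤a a≤b b≤q₃ =
      machine-kept prefix (A ∘ prefix) a≤b (λ q a≤q q<b → free q (≤-trans q₁≤a a≤q) (<-≤-trans q<b b≤q₃))

    X-late₁ : slot q₁ X ≡ suc T
    X-late₁ = X-late q₁ q₁≤q₃ ≤-refl F (λ { refl → refl }) (λ _ → refl) F-active

    X-late₃ : slot q₃ X ≡ suc T
    X-late₃ = X-late q₃ ≤-refl q₁≤q₃ earlyJobs₃ earlyJobs₃-injective earlyJobs₃-early earlyJobs₃-active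
      where
        earlyJobs₃-injective : Injective _≡_ _≡_ earlyJobs₃
        earlyJobs₃-injective {fz}   {fz}   _    = refl
        earlyJobs₃-injective {fs i} {fs j} refl = refl
        earlyJobs₃-early : ∀ i → request r (earlyJobs₃ i) ≡ ins T (1 + T)
        earlyJobs₃-early fz     = refl
        earlyJobs₃-early (fs i) = refl

    Y-late : ∀ i q → q₁ ≤ q → q ≤ q₂ → slot q (Y i) ≡ suc T
    Y-late i q q₁≤q q≤q₂ = slot-late q (≤-trans q≤q₂ q₂≤q₃) (Y i) (Y-active i q q₁≤q q≤q₂) refl

    Z-late : ∀ q → q₂ ≤ q → q ≤ q₃ → slot q Z ≡ suc T
    Z-late q q₂≤q q≤q₃ = slot-late q q≤q₃ Z (Z-active q q₂≤q) refl

    X≢Z : machine q₃ X ≢ machine q₃ Z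
    X≢Z sameMachine = contradiction (same-kind q₃ ≤-refl X Z (X-active q₃ q₁≤q₃) (Z-active q₃ q₂≤q₃)
                                 (trans X-late₃ (sym (Z-late q₃ q₂≤q₃ ≤-refl))) sameMachine) λ ()

    X≢Y : ∀ i → machine q₃ X ≢ machine q₂ (Y i)
    X≢Y i sameMachine = contradiction (same-kind q₁ q₁≤q₃ X (Y i) (X-active q₁ ≤-refl) (Y-active i q₁ ≤-refl q₁≤q₂)
        (trans X-late₁ (sym (Y-late i q₁ ≤-refl q₁≤q₂)))
        (trans (machine-constant X ≤-refl q₁≤q₃ ≤-refl (λ q q₁≤q _ → X-active q q₁≤q))
          (trans sameMachine (sym (machine-constant (Y i) ≤-refl q₁≤q₂ q₂≤q₃ (Y-active i)))))) λ ()

    Z≢Y : ∀ i → machine q₃ Z ≢ machine q₂ (Y i)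
    Z≢Y i sameMachine = contradiction (same-kind q₂ q₂≤q₃ Z (Y i) (Z-active q₂ ≤-refl) (Y-active i q₂ q₁≤q₂ ≤-refl)
        (trans (Z-late q₂ ≤-refl q₂≤q₃) (sym (Y-late i q₂ q₁≤q₂ ≤-refl)))
        (trans (machine-constant Z q₁≤q₂ q₂≤q₃ ≤-refl (λ q q₂≤q _ → Z-active q q₂≤q)) sameMachine)) λ ()

    machines : Fin (suc m) → Fin m
    machines fz          = machine q₃ X
    machines (fs fz)     = machine q₃ Z
    machines (fs (fs i)) = machine q₂ (Y i)

    machines-injective : Injective _≡_ _≡_ machines
    machines-injective {fz}        {fz}        _  = refl
    machines-injective {fz}        {fs fz}     eq = contradiction eq X≢Z
    machines-injective {fz}        {fs (fs j)} eq = contradiction eq (X≢Y j)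
    machines-injective {fs fz}     {fz}        eq = contradiction (sym eq) X≢Z
    machines-injective {fs fz}     {fs fz}     _  = refl
    machines-injective {fs fz}     {fs (fs j)} eq = contradiction eq (Z≢Y j)
    machines-injective {fs (fs i)} {fz}        eq = contradiction (sym eq) (X≢Y i)
    machines-injective {fs (fs i)} {fs fz}     eq = contradiction (sym eq) (Z≢Y i)
    machines-injective {fs (fs i)} {fs (fs j)} eq = cong (fs ∘ fs) (Y-injective (same-kind q₂ q₂≤q₃ (Y i) (Y j)
        (Y-active i q₂ q₁≤q₂ ≤-refl) (Y-active j q₂ q₁≤q₂ ≤-refl)
        (trans (Y-late i q₂ q₁≤q₂ ≤-refl) (sym (Y-late j q₂ q₁≤q₂ ≤-refl))) eq))
      where
        Y-injective : ∀ {i j} → Y i ≡ Y j → i ≡ j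
        Y-injective refl = refl

    impossible : ⊥
    impossible = 1+n≰n (injective⇒≤ machines-injective)

  round-forces-migration : ∀ A r → (∀ q → q ≤ suc (index r F′) → Feasible m (prefix q) (A (prefix q))) →
    ¬ (∀ q → index r DF ≤ q → q < suc (index r F′) → migrationAt A q ≡ 0)
  round-forces-migration A r feasible free = RoundWithoutMigration.impossible A r feasible free

  module _ (s : ℕ) (A : Scheduler m)
           (feasible : ∀ k → k ≤ s → Feasible m (take k (prefix s)) (A (take k (prefix s)))) where

    cost : ℕ → ℕ
    cost = costUpTo m (prefix s) A

    round-cost : ∀ r → L + r * L ≤ s → cost (r * L) < cost (L + r * L)
    round-cost r end≤s with costUpTo-grows-or-free (prefix s) A (m≤n+m (r * L) L)
    ... | inj₁ grows = grows
    ... | inj₂ free  = ⊥-elim (round-forces-migration A r feasible′ free′)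
      where
        F′<end : suc (index r F′) ≤ L + r * L
        F′<end = +-monoˡ-≤ (r * L) (pos<L F′)
        feasible′ : ∀ q → q ≤ suc (index r F′) → Feasible m (prefix q) (A (prefix q))
        feasible′ q q≤F′ = subst (λ ρ → Feasible m ρ (A ρ)) (take-applyUpTo requestAt q≤s) (feasible q q≤s)
          where q≤s = ≤-trans q≤F′ (≤-trans F′<end end≤s)
        free′ : ∀ q → index r DF ≤ q → q < suc (index r F′) → migrationAt A q ≡ 0
        free′ q DF≤q q≤F′ =
          subst (_≡ 0) (cong₂ (λ ρ ρ′ → migration m ρ ρ′ (A ρ) (A ρ′))
                              (take-applyUpTo requestAt (<⇒≤ q<s)) (take-applyUpTo requestAt q<s))
            (free q (≤-trans (m≤n+m (r * L) (pos DF)) DF≤q) (<-≤-trans q≤F′ F′<end))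
          where q<s = <-≤-trans q≤F′ (≤-trans F′<end end≤s)

    rounds-cost : ∀ R → R * L ≤ s → R ≤ cost (R * L)
    rounds-cost zero    _     = z≤n
    rounds-cost (suc R) end≤s =
      ≤-<-trans (rounds-cost R (≤-trans (m≤n+m (R * L) L) end≤s)) (round-cost R end≤s)

    totalCost-lower-bound : L ≤ s → s ≤ (L + L) * totalCost m (prefix s) A
    totalCost-lower-bound L≤s = ≤-trans (≤-double-quotient s L L≤s) (*-monoʳ-≤ (L + L) rounds≤total)
      where
        rounds≤total : s / L ≤ totalCost m (prefix s) A
        rounds≤total = ≤-trans (rounds-cost (s / L) (m/n*n≤m s L))
          (costUpTo-mono (prefix s) A (subst (s / L * L ≤_) (sym (length-applyUpTo requestAt s)) (m/n*n≤m s L)))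

lemma7 : (m : ℕ) → 2 ≤ m →
    ∃[ c ] (1 ≤ c × ∃[ s₀ ] (∀ s → s₀ ≤ s →
      ∃[ σ ] (length σ ≡ s × ValidSeq σ × FeasiblePrefixes m σ ×
        ((A : Scheduler m) →
          (∀ k → k ≤ s → Feasible m (take k σ) (A (take k σ))) →
          s ≤ c * totalCost m σ A))))
lemma7 (suc (suc n)) (s≤s (s≤s z≤n)) =
  L + L , s≤s z≤n , L , λ s L≤s →
    prefix s , length-applyUpTo requestAt s , prefix-valid s , feasible-prefixes s ,
    λ A feasible → totalCost-lower-bound s A feasible L≤s
  where open Adversary n
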